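{- Let $n$ be an integer greater than $2$. Then $F(P_2 \square C_n) \geq \left\lceil \frac{n}{2} \right\rceil + 3\left\lfloor \frac{n}{4} \right\rfloor$.
   Context: All graphs are simple, finite and undirected; $P_k$ and $C_k$ are the path and cycle on $k$ vertices. The Cartesian product $G \square H$ has vertex set $V(G)\times V(H)$, with $(u,v)$ adjacent to $(u',v')$ iff either $u=u'$ and $vv'\in E(H)$, or $v=v'$ and $uu'\in E(G)$. Zero forcing: each vertex is blue or white; starting from an initial set $S$ of blue vertices, repeatedly apply the color-change rule: if a blue vertex $u$ has exactly one white neighbor $v$, color $v$ blue. $S$ is a zero forcing set if eventually all vertices are blue, and a failed zero forcing set otherwise. $F(G)$ denotes the maximum cardinality of a failed zero forcing set of $G$. -}

module Defs where

open import Data.Nat using (ℕ; suc; _+_; _*_; _≥_; _/_; ⌈_/2⌉)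
open import Data.Fin using (Fin; zero; suc; toℕ; remQuot)
open import Data.Fin.Subset using (Subset; _∈_; _∉_; ∣_∣)
open import Data.Product using (Σ; _×_; _,_; ∃; proj₁; proj₂)
open import Data.Sum using (_⊎_)
open import Relation.Binary.PropositionalEquality using (_≡_; _≢_)
open import Relation.Nullary using (¬_)
open import Level using (0ℓ)

record Graph (n : ℕ) : Set₁ where
  constructor graph
  field
    Adj : Fin n → Fin n → Set
open Graph public

PathAdj : ∀ {k} → Fin k → Fin k → Set
PathAdj i j = (suc (toℕ i) ≡ toℕ j) ⊎ (suc (toℕ j) ≡ toℕ i)

CycleAdj : ∀ k → Fin k → Fin k → Set
CycleAdj k i j = (suc (toℕ i) ≡ toℕ j) ⊎ (suc (toℕ j) ≡ toℕ i)
               ⊎ ((suc (toℕ i) ≡ k) × (toℕ j ≡ 0))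
               ⊎ ((suc (toℕ j) ≡ k) × (toℕ i ≡ 0))

BoxAdj : ∀ {m n} → (Fin m → Fin m → Set) → (Fin n → Fin n → Set)
       → Fin (m * n) → Fin (m * n) → Set
BoxAdj {m} {n} AG AH x y with remQuot {m} n x | remQuot {m} n y
... | (u , v) | (u' , v') = ((u ≡ u') × AH v v') ⊎ ((v ≡ v') × AG u u')

-- Zero forcing closure: Forced G S v means v becomes blue when starting
-- from the blue set S and repeatedly applying the color-change rule
-- (a blue vertex u with exactly one white neighbour v forces v).
-- Since the rule is monotone, the final blue set is the least set
-- containing S and closed under the rule, given inductively:
data Forced {n : ℕ} (G : Graph n) (S : Subset n) : Fin n → Set where
  initial : ∀ {v} → v ∈ S → Forced G S v
  force   : ∀ {u v} → Forced G S u → Adj G u v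
          → (∀ w → Adj G u w → w ≢ v → Forced G S w)
          → Forced G S v

IsZeroForcingSet : ∀ {n} → Graph n → Subset n → Set
IsZeroForcingSet G S = ∀ v → Forced G S v

IsFailedZeroForcingSet : ∀ {n} → Graph n → Subset n → Set
IsFailedZeroForcingSet G S = ¬ IsZeroForcingSet G S

-- "F(G) ≥ k": some failed zero forcing set has cardinality at least k
-- (equivalently, the maximum cardinality of a failed zero forcing set is ≥ k).
FailedZFAtLeast : ∀ {n} → Graph n → ℕ → Set
FailedZFAtLeast {n} G k =
  Σ (Subset n) λ S → IsFailedZeroForcingSet G S × ∣ S ∣ ≥ k

P2□C : ∀ n → Graph (2 * n)
P2□C n = graph (BoxAdj {2} {n} PathAdj (CycleAdj n))

{-# OPTIONS --safe #-}
module Submission where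

-- A set W of vertices is a fort if no vertex outside W has exactly one
-- neighbour in W.  No vertex of a fort can ever be forced, so the complement
-- of a nonempty fort is a failed zero forcing set.  In P₂ □ Cₙ we describe a
-- fort column by column: repeating the columns (top, none, top, bottom), with
-- a suitable tail for n mod 4, gives a fort with 3 vertices per block of four
-- columns, and its complement has the required size.

open import Defs
open import Data.Bool using (Bool; true; false; not; _∧_; _∨_; T)
open import Data.Bool.Properties using (T-∧; T-∨; T-≡)
open import Data.Empty using (⊥-elim)
open import Data.Fin using (Fin; zero; suc; toℕ; fromℕ; fromℕ<; inject₁; opposite; combine; remQuot)
open import Data.Fin.Properties using (toℕ-injective; toℕ-fromℕ<; toℕ-fromℕ; toℕ-inject₁; toℕ<n; remQuot-combine; combine-remQuot)
open import Data.Fin.Subset using (Subset; _∈_; _∉_; ∁; ∣_∣; Nonempty)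
open import Data.Fin.Subset.Properties using (x∈∁p⇒x∉p)
open import Data.Nat using (ℕ; zero; suc; _+_; _*_; _<_; _>_; _≤_; _/_; ⌈_/2⌉; _<?_; s≤s; z≤n)
open import Data.Nat.DivMod using (m/n≡1+[m∸n]/n)
open import Data.Nat.Properties using (≤∧≮⇒≡; <-irrefl; <-trans; m≢1+n+m; 0≢1+n; suc-injective; +-identityʳ; +-monoʳ-≤; module ≤-Reasoning)
open import Data.Nat.Tactic.RingSolver using (solve-∀)
open import Data.Product using (Σ; _×_; _,_; proj₁; proj₂; uncurry)
open import Data.Sum using (_⊎_; inj₁; inj₂)
open import Data.Unit using (tt)
open import Data.Vec using (Vec; []; _∷_; _++_; _∷ʳ_; lookup; map; concat; tabulate)
open import Data.Vec.Properties using (lookup-concat; lookup∘tabulate; lookup-map; map-concat; []=⇒lookup; lookup⇒[]=)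
open import Function using (_∘_)
open import Function.Bundles using (Equivalence)
open import Relation.Binary.PropositionalEquality
open import Relation.Nullary using (¬_; yes; no)

open Equivalence using (to; from)

-- Forts and failed zero forcing sets

IsFort : ∀ {n} → Graph n → Subset n → Set
IsFort {n} G W = ∀ {u v} → u ∉ W → Adj G u v → v ∈ W →
  Σ (Fin n) λ w → Adj G u w × w ≢ v × w ∈ W

forced-∉-fort : ∀ {n} {G : Graph n} {S W} → IsFort G W → (∀ {v} → v ∈ S → v ∉ W) →
                ∀ {v} → Forced G S v → v ∉ W
forced-∉-fort fort S-outside (initial v∈S) = S-outside v∈S
forced-∉-fort fort S-outside (force u-blue u∼v others-blue) v∈W
  with fort (forced-∉-fort fort S-outside u-blue) u∼v v∈W
... | w , u∼w , w≢v , w∈W = forced-∉-fort fort S-outside (others-blue w u∼w w≢v) w∈W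

∁-fort-failed : ∀ {n} {G : Graph n} {W} → IsFort G W → Nonempty W →
                IsFailedZeroForcingSet G (∁ W)
∁-fort-failed fort (v , v∈W) all-forced = forced-∉-fort fort x∈∁p⇒x∉p (all-forced v) v∈W

∣p++q∣≡∣p∣+∣q∣ : ∀ {m n} (p : Subset m) (q : Subset n) → ∣ p ++ q ∣ ≡ ∣ p ∣ + ∣ q ∣
∣p++q∣≡∣p∣+∣q∣ []          q = refl
∣p++q∣≡∣p∣+∣q∣ (true ∷ p)  q = cong suc (∣p++q∣≡∣p∣+∣q∣ p q)
∣p++q∣≡∣p∣+∣q∣ (false ∷ p) q = ∣p++q∣≡∣p∣+∣q∣ p q

∈⇒T-lookup : ∀ {n} {p : Subset n} {x} → x ∈ p → T (lookup p x)
∈⇒T-lookup x∈p = from T-≡ ([]=⇒lookup x∈p)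

T-lookup⇒∈ : ∀ {n} {p : Subset n} {x} → T (lookup p x) → x ∈ p
T-lookup⇒∈ {p = p} {x} t = lookup⇒[]= x p (to T-≡ t)

prev next : ∀ {n} → Fin n → Fin n
prev {suc m} zero    = fromℕ m
prev {suc m} (suc c) = inject₁ c
next {suc m} c with suc (toℕ c) <? suc m
... | yes c+1<n = fromℕ< c+1<n
... | no  _     = zero

prev-spec : ∀ {n} (c : Fin n) →
            toℕ c ≡ suc (toℕ (prev c)) ⊎ (toℕ c ≡ 0 × suc (toℕ (prev c)) ≡ n)
prev-spec {suc m} zero    = inj₂ (refl , cong suc (toℕ-fromℕ m))
prev-spec {suc m} (suc c) = inj₁ (cong suc (sym (toℕ-inject₁ c)))

next-spec : ∀ {n} (c : Fin n) →
            (suc (toℕ c) < n × toℕ (next c) ≡ suc (toℕ c)) ⊎ (suc (toℕ c) ≡ n × toℕ (next c) ≡ 0)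
next-spec {suc m} c with suc (toℕ c) <? suc m
... | yes c+1<n = inj₁ (c+1<n , toℕ-fromℕ< c+1<n)
... | no  c+1≮n = inj₂ (≤∧≮⇒≡ (toℕ<n c) c+1≮n , refl)

cycleAdj-prev : ∀ {n} (c : Fin n) → CycleAdj n c (prev c)
cycleAdj-prev c with prev-spec c
... | inj₁ c≡prev+1         = inj₂ (inj₁ (sym c≡prev+1))
... | inj₂ (c≡0 , prev+1≡n) = inj₂ (inj₂ (inj₂ (prev+1≡n , c≡0)))

cycleAdj-next : ∀ {n} (c : Fin n) → CycleAdj n c (next c)
cycleAdj-next c with next-spec c
... | inj₁ (_ , next≡c+1)   = inj₁ (sym next≡c+1)
... | inj₂ (c+1≡n , next≡0) = inj₂ (inj₂ (inj₁ (c+1≡n , next≡0)))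

cycleAdj⇒prev⊎next : ∀ {n} {c c' : Fin n} → CycleAdj n c c' → c' ≡ prev c ⊎ c' ≡ next c
cycleAdj⇒prev⊎next {c = c} {c'} (inj₁ c+1≡c') with next-spec c
... | inj₁ (_ , next≡c+1) = inj₂ (toℕ-injective (trans (sym c+1≡c') (sym next≡c+1)))
... | inj₂ (c+1≡n , _) = ⊥-elim (<-irrefl (trans (sym c+1≡c') c+1≡n) (toℕ<n c'))
cycleAdj⇒prev⊎next {c = c} (inj₂ (inj₁ c'+1≡c)) with prev-spec c
... | inj₁ c≡prev+1       = inj₁ (toℕ-injective (suc-injective (trans c'+1≡c c≡prev+1)))
... | inj₂ (c≡0 , _)   = ⊥-elim (0≢1+n (sym (trans c'+1≡c c≡0)))
cycleAdj⇒prev⊎next {c = c} (inj₂ (inj₂ (inj₁ (c+1≡n , c'≡0)))) with next-spec c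
... | inj₁ (c+1<n , _) = ⊥-elim (<-irrefl c+1≡n c+1<n)
... | inj₂ (_ , next≡0)   = inj₂ (toℕ-injective (trans c'≡0 (sym next≡0)))
cycleAdj⇒prev⊎next {c = c} (inj₂ (inj₂ (inj₂ (c'+1≡n , c≡0)))) with prev-spec c
... | inj₁ c≡prev+1       = ⊥-elim (0≢1+n (trans (sym c≡0) c≡prev+1))
... | inj₂ (_ , prev+1≡n) = inj₁ (toℕ-injective (suc-injective (trans c'+1≡n (sym prev+1≡n))))

prev≢next : ∀ {n} → 2 < n → (c : Fin n) → prev c ≢ next c
prev≢next {n} 2<n c prev≡next with prev-spec c | next-spec c | cong toℕ prev≡next
... | inj₁ c≡prev+1 | inj₁ (_ , next≡c+1) | prev≡next' =
  m≢1+n+m _ {1} (trans prev≡next' (trans next≡c+1 (cong suc c≡prev+1)))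
... | inj₁ c≡prev+1 | inj₂ (c+1≡n , next≡0) | prev≡next' =
  <-irrefl (sym (trans (sym c+1≡n) (cong suc (trans c≡prev+1 (cong suc (trans prev≡next' next≡0)))))) 2<n
... | inj₂ (c≡0 , prev+1≡n) | inj₁ (_ , next≡c+1) | prev≡next' =
  <-irrefl (sym (trans (sym prev+1≡n) (cong suc (trans prev≡next' (trans next≡c+1 (cong suc c≡0)))))) 2<n
... | inj₂ (c≡0 , _) | inj₂ (c+1≡n , _) | _ =
  <-irrefl (sym (trans (sym c+1≡n) (cong suc c≡0))) (<-trans (s≤s (s≤s z≤n)) 2<n)

Coord : ℕ → Set
Coord n = Fin 2 × Fin n

coord : ∀ {n} → Fin (2 * n) → Coord n
coord {n} = remQuot n

vertex : ∀ {n} → Coord n → Fin (2 * n)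
vertex = uncurry combine

coord-vertex : ∀ {n} (x : Coord n) → coord (vertex x) ≡ x
coord-vertex (a , c) = remQuot-combine a c

vertex-coord : ∀ {n} (u : Fin (2 * n)) → vertex (coord {n} u) ≡ u
vertex-coord {n} = combine-remQuot {2} n

-- Adj (P2□C n) u v unfolds to coord u ∼ coord v.
infix 4 _∼_
_∼_ : ∀ {n} → Coord n → Coord n → Set
_∼_ {n} (a , c) (b , c') = ((a ≡ b) × CycleAdj n c c') ⊎ ((c ≡ c') × PathAdj a b)

data Dir : Set where
  across back forward : Dir

neighbour : ∀ {n} → Coord n → Dir → Coord n
neighbour (a , c) across  = opposite a , c
neighbour (a , c) back    = a , prev c
neighbour (a , c) forward = a , next c

opposite≢ : (a : Fin 2) → opposite a ≢ a
opposite≢ zero       ()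
opposite≢ (suc zero) ()

pathAdj-opposite : (a : Fin 2) → PathAdj a (opposite a)
pathAdj-opposite zero       = inj₁ refl
pathAdj-opposite (suc zero) = inj₂ refl

pathAdj⇒opposite : {a b : Fin 2} → PathAdj a b → b ≡ opposite a
pathAdj⇒opposite {zero}     {zero}     (inj₁ ())
pathAdj⇒opposite {zero}     {zero}     (inj₂ ())
pathAdj⇒opposite {zero}     {suc zero} _ = refl
pathAdj⇒opposite {suc zero} {zero}     _ = refl
pathAdj⇒opposite {suc zero} {suc zero} (inj₁ ())
pathAdj⇒opposite {suc zero} {suc zero} (inj₂ ())

∼-neighbour : ∀ {n} (x : Coord n) d → x ∼ neighbour x d
∼-neighbour (a , c) across  = inj₂ (refl , pathAdj-opposite a)
∼-neighbour (a , c) back    = inj₁ (refl , cycleAdj-prev c)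
∼-neighbour (a , c) forward = inj₁ (refl , cycleAdj-next c)

∼⇒neighbour : ∀ {n} {x y : Coord n} → x ∼ y → Σ Dir λ d → y ≡ neighbour x d
∼⇒neighbour (inj₁ (refl , c∼c')) with cycleAdj⇒prev⊎next c∼c'
... | inj₁ refl = back , refl
... | inj₂ refl = forward , refl
∼⇒neighbour {x = a , c} (inj₂ (refl , a∼b)) = across , cong (_, c) (pathAdj⇒opposite a∼b)

neighbour-injective : ∀ {n} → 2 < n → (x : Coord n) {d d' : Dir} →
                      neighbour x d ≡ neighbour x d' → d ≡ d'
neighbour-injective _   _       {across}  {across}  _  = refl
neighbour-injective _   _       {back}    {back}    _  = refl
neighbour-injective _   _       {forward} {forward} _  = refl
neighbour-injective _   (a , c) {across}  {back}    eq = ⊥-elim (opposite≢ a (cong proj₁ eq))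
neighbour-injective _   (a , c) {across}  {forward} eq = ⊥-elim (opposite≢ a (cong proj₁ eq))
neighbour-injective _   (a , c) {back}    {across}  eq = ⊥-elim (opposite≢ a (sym (cong proj₁ eq)))
neighbour-injective _   (a , c) {forward} {across}  eq = ⊥-elim (opposite≢ a (sym (cong proj₁ eq)))
neighbour-injective 2<n (a , c) {back}    {forward} eq = ⊥-elim (prev≢next 2<n c (cong proj₂ eq))
neighbour-injective 2<n (a , c) {forward} {back}    eq = ⊥-elim (prev≢next 2<n c (sym (cong proj₂ eq)))

LocalFort : (Dir → Bool) → Set
LocalFort f = ∀ d → T (f d) → Σ Dir λ d' → d' ≢ d × T (f d')

companions : Dir → Dir × Dir
companions across  = back , forward
companions back    = across , forward
companions forward = across , back

companion₁≢ : ∀ d → proj₁ (companions d) ≢ d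
companion₁≢ across  ()
companion₁≢ back    ()
companion₁≢ forward ()

companion₂≢ : ∀ d → proj₂ (companions d) ≢ d
companion₂≢ across  ()
companion₂≢ back    ()
companion₂≢ forward ()

companionedᵇ : (Dir → Bool) → Dir → Bool
companionedᵇ f d = not (f d) ∨ f (proj₁ (companions d)) ∨ f (proj₂ (companions d))

allDirᵇ : (Dir → Bool) → Bool
allDirᵇ p = p across ∧ p back ∧ p forward

allDirᵇ-sound : ∀ p → T (allDirᵇ p) → ∀ d → T (p d)
allDirᵇ-sound p ok across  = proj₁ (to (T-∧ {p across}) ok)
allDirᵇ-sound p ok back    = proj₁ (to (T-∧ {p back}) (proj₂ (to (T-∧ {p across}) ok)))
allDirᵇ-sound p ok forward = proj₂ (to (T-∧ {p back}) (proj₂ (to (T-∧ {p across}) ok)))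

LocalFortᵇ : (Dir → Bool) → Bool
LocalFortᵇ f = allDirᵇ (companionedᵇ f)

LocalFortᵇ⇒LocalFort : ∀ f → T (LocalFortᵇ f) → LocalFort f
LocalFortᵇ⇒LocalFort f ok d fd with f d | allDirᵇ-sound (companionedᵇ f) ok d
LocalFortᵇ⇒LocalFort f ok d () | false | _
LocalFortᵇ⇒LocalFort f ok d _  | true  | c with to T-∨ c
... | inj₁ c₁ = proj₁ (companions d) , companion₁≢ d , c₁
... | inj₂ c₂ = proj₂ (companions d) , companion₂≢ d , c₂

P2□C-fort : ∀ {n} → 2 < n → (W : Subset (2 * n)) →
            (∀ x → vertex x ∉ W → LocalFort (λ d → lookup W (vertex (neighbour x d)))) →
            IsFort (P2□C n) W
P2□C-fort {n} 2<n W local {u} {v} u∉W u∼v v∈W =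
  vertex (neighbour x d') , u∼w , w≢v , T-lookup⇒∈ w∈W
  where
    x : Coord n
    x = coord {n} u
    d : Dir
    d = proj₁ (∼⇒neighbour u∼v)
    v≡ : v ≡ vertex (neighbour x d)
    v≡ = trans (sym (vertex-coord {n} v)) (cong vertex (proj₂ (∼⇒neighbour u∼v)))
    x∉W : vertex x ∉ W
    x∉W = u∉W ∘ subst (_∈ W) (vertex-coord {n} u)
    companion : Σ Dir λ d' → d' ≢ d × T (lookup W (vertex (neighbour x d')))
    companion = local x x∉W d (∈⇒T-lookup (subst (_∈ W) v≡ v∈W))
    d' : Dir
    d' = proj₁ companion
    w∈W : T (lookup W (vertex (neighbour x d')))
    w∈W = proj₂ (proj₂ companion)
    u∼w : coord u ∼ coord (vertex (neighbour x d'))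
    u∼w = subst (x ∼_) (sym (coord-vertex _)) (∼-neighbour x d')
    w≢v : vertex (neighbour x d') ≢ v
    w≢v eq = proj₁ (proj₂ companion) (neighbour-injective 2<n x
      (trans (sym (coord-vertex _)) (trans (cong coord (trans eq v≡)) (coord-vertex _))))

-- Cyclic windows from linear ones

CyclicWindows : ∀ {A : Set} {n} → (A → A → A → Bool) → Vec A n → Set
CyclicWindows P w = ∀ c → T (P (lookup w (prev c)) (lookup w c) (lookup w (next c)))

windowsᵇ : ∀ {A : Set} {n} → (A → A → A → Bool) → Vec A n → Bool
windowsᵇ P (x ∷ y ∷ z ∷ r) = P x y z ∧ windowsᵇ P (y ∷ z ∷ r)
windowsᵇ P _               = true

module _ {A : Set} where

  lookup-∷ʳ-inject₁ : ∀ {n} (xs : Vec A n) y i → lookup (xs ∷ʳ y) (inject₁ i) ≡ lookup xs i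
  lookup-∷ʳ-inject₁ (x ∷ xs) y zero    = refl
  lookup-∷ʳ-inject₁ (x ∷ xs) y (suc i) = lookup-∷ʳ-inject₁ xs y i

  lookup-∷ʳ-fromℕ : ∀ {n} (xs : Vec A n) y → lookup (xs ∷ʳ y) (fromℕ n) ≡ y
  lookup-∷ʳ-fromℕ []       y = refl
  lookup-∷ʳ-fromℕ (x ∷ xs) y = lookup-∷ʳ-fromℕ xs y

  windowsᵇ-lookup : ∀ {n} P x (w : Vec A n) y → T (windowsᵇ P (x ∷ (w ∷ʳ y))) →
    ∀ c → T (P (lookup (x ∷ w) (inject₁ c)) (lookup w c) (lookup (w ∷ʳ y) (suc c)))
  windowsᵇ-lookup P x (a ∷ [])    y ok zero    = proj₁ (to (T-∧ {P x a y}) ok)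
  windowsᵇ-lookup P x (a ∷ b ∷ w) y ok zero    = proj₁ (to (T-∧ {P x a b}) ok)
  windowsᵇ-lookup P x (a ∷ b ∷ w) y ok (suc c) =
    windowsᵇ-lookup P a (b ∷ w) y (proj₂ (to (T-∧ {P x a b}) ok)) c

  lookup-prev : ∀ {m} (w : Vec A (suc m)) c → lookup (lookup w (fromℕ m) ∷ w) (inject₁ c) ≡ lookup w (prev c)
  lookup-prev w zero    = refl
  lookup-prev w (suc c) = refl

  lookup-next : ∀ {m} (w : Vec A (suc m)) c → lookup (w ∷ʳ lookup w zero) (suc c) ≡ lookup w (next c)
  lookup-next {m} w c with next-spec c
  ... | inj₁ (_ , next≡c+1) =
    trans (cong (lookup (w ∷ʳ _)) (toℕ-injective (trans (sym next≡c+1) (sym (toℕ-inject₁ (next c))))))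
          (lookup-∷ʳ-inject₁ w _ (next c))
  ... | inj₂ (c+1≡n , next≡0) =
    trans (cong (lookup (w ∷ʳ _)) (toℕ-injective (trans c+1≡n (sym (toℕ-fromℕ (suc m))))))
          (trans (lookup-∷ʳ-fromℕ w _) (cong (lookup w) (sym (toℕ-injective {j = zero} next≡0))))

  cyclic-from-linear : ∀ {m} P (w : Vec A (suc m)) →
    T (windowsᵇ P (lookup w (fromℕ m) ∷ (w ∷ʳ lookup w zero))) → CyclicWindows P w
  cyclic-from-linear P w ok c =
    subst₂ (λ l r → T (P l (lookup w c) r)) (lookup-prev w c) (lookup-next w c)
      (windowsᵇ-lookup P _ w _ ok c)

-- A column is named by which of its two vertices lies in the fort.
data Column : Set where
  none top bottom : Column

inFort : Fin 2 → Column → Bool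
inFort zero       top    = true
inFort (suc zero) bottom = true
inFort _          _      = false

row : ∀ {n} → Fin 2 → Vec Column n → Subset n
row a = map (inFort a)

fortOf : ∀ {n} → Vec Column n → Subset (2 * n)
fortOf w = concat (tabulate λ a → row a w)

lookup-fortOf : ∀ {n} (w : Vec Column n) a c → lookup (fortOf w) (vertex (a , c)) ≡ inFort a (lookup w c)
lookup-fortOf w a c = begin
  lookup (fortOf w) (combine a c)              ≡⟨ lookup-concat (tabulate λ a → row a w) a c ⟩
  lookup (lookup (tabulate λ a → row a w) a) c ≡⟨ cong (λ r → lookup r c) (lookup∘tabulate (λ a → row a w) a) ⟩
  lookup (row a w) c                           ≡⟨ lookup-map c (inFort a) w ⟩
  inFort a (lookup w c)                        ∎
  where open ≡-Reasoning

∣∁fortOf∣ : ∀ {n} (w : Vec Column n) → ∣ ∁ (fortOf w) ∣ ≡ ∣ ∁ (row zero w) ∣ + ∣ ∁ (row (suc zero) w) ∣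
∣∁fortOf∣ w = begin
  ∣ ∁ (fortOf w) ∣                                   ≡⟨ cong ∣_∣ (map-concat not (tabulate λ a → row a w)) ⟩
  ∣ ∁ (row zero w) ++ (∁ (row (suc zero) w) ++ []) ∣   ≡⟨ ∣p++q∣≡∣p∣+∣q∣ (∁ (row zero w)) _ ⟩
  ∣ ∁ (row zero w) ∣ + ∣ ∁ (row (suc zero) w) ++ [] ∣ ≡⟨ cong (∣ ∁ (row zero w) ∣ +_) ∣r₁++[]∣ ⟩
  ∣ ∁ (row zero w) ∣ + ∣ ∁ (row (suc zero) w) ∣        ∎
  where
    open ≡-Reasoning
    ∣r₁++[]∣ : ∣ ∁ (row (suc zero) w) ++ [] ∣ ≡ ∣ ∁ (row (suc zero) w) ∣
    ∣r₁++[]∣ = trans (∣p++q∣≡∣p∣+∣q∣ (∁ (row (suc zero) w)) []) (+-identityʳ _)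

around : Fin 2 → Column → Column → Column → Dir → Bool
around a L M R across  = inFort (opposite a) M
around a L M R back    = inFort a L
around a L M R forward = inFort a R

fortRowᵇ : Fin 2 → Column → Column → Column → Bool
fortRowᵇ a L M R = inFort a M ∨ LocalFortᵇ (around a L M R)

fortWindowᵇ : Column → Column → Column → Bool
fortWindowᵇ L M R = fortRowᵇ zero L M R ∧ fortRowᵇ (suc zero) L M R

fortWindow-sound : ∀ {L M R} → T (fortWindowᵇ L M R) →
                   ∀ a → ¬ T (inFort a M) → LocalFort (around a L M R)
fortWindow-sound {L} {M} {R} ok a a∉ with to (T-∨ {inFort a M}) (fortRow a)
  where
    fortRow : ∀ a → T (fortRowᵇ a L M R)
    fortRow zero       = proj₁ (to (T-∧ {fortRowᵇ zero L M R}) ok)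
    fortRow (suc zero) = proj₂ (to (T-∧ {fortRowᵇ zero L M R}) ok)
... | inj₁ a∈ = ⊥-elim (a∉ a∈)
... | inj₂ lf = LocalFortᵇ⇒LocalFort (around a L M R) lf

LocalFort-resp : ∀ {f g} → (∀ d → f d ≡ g d) → LocalFort f → LocalFort g
LocalFort-resp f≗g lf d gd with lf d (subst T (sym (f≗g d)) gd)
... | d' , d'≢d , fd' = d' , d'≢d , subst T (f≗g d') fd'

lookup-fortOf-neighbour : ∀ {n} (w : Vec Column n) a c d →
  around a (lookup w (prev c)) (lookup w c) (lookup w (next c)) d ≡ lookup (fortOf w) (vertex (neighbour (a , c) d))
lookup-fortOf-neighbour w a c across  = sym (lookup-fortOf w (opposite a) c)
lookup-fortOf-neighbour w a c back    = sym (lookup-fortOf w a (prev c))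
lookup-fortOf-neighbour w a c forward = sym (lookup-fortOf w a (next c))

fortOf-isFort : ∀ {n} → 2 < n → (w : Vec Column n) → CyclicWindows fortWindowᵇ w → IsFort (P2□C n) (fortOf w)
fortOf-isFort 2<n w windows = P2□C-fort 2<n (fortOf w) λ where
  (a , c) x∉W → LocalFort-resp (lookup-fortOf-neighbour w a c)
    (fortWindow-sound (windows c) a (x∉W ∘ T-lookup⇒∈ ∘ subst T (sym (lookup-fortOf w a c))))

fortOf-nonempty : ∀ {n} (w : Vec Column (suc n)) → lookup w zero ≡ top → Nonempty (fortOf w)
fortOf-nonempty w w₀≡top =
  vertex (zero , zero) , T-lookup⇒∈ (subst T (sym (trans (lookup-fortOf w zero zero) (cong (inFort zero) w₀≡top))) tt)

-- A fort of the required size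

fortColumns : (n : ℕ) → Vec Column n
fortColumns 0 = []
fortColumns 1 = bottom ∷ []
fortColumns 2 = none ∷ bottom ∷ []
fortColumns 3 = top ∷ top ∷ bottom ∷ []
fortColumns (suc (suc (suc (suc n)))) = top ∷ none ∷ top ∷ bottom ∷ fortColumns n

fortColumns-head : ∀ m → lookup (fortColumns (3 + m)) zero ≡ top
fortColumns-head zero    = refl
fortColumns-head (suc m) = refl

fortColumns-windows : ∀ m → T (windowsᵇ fortWindowᵇ (fortColumns (4 + m) ∷ʳ top))
fortColumns-windows 0 = tt
fortColumns-windows 1 = tt
fortColumns-windows 2 = tt
fortColumns-windows 3 = tt
fortColumns-windows (suc (suc (suc (suc m)))) = fortColumns-windows m

fortColumns-wrap : ∀ m → T (fortWindowᵇ (lookup (fortColumns (4 + m)) (fromℕ (3 + m))) top none)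
fortColumns-wrap 0 = tt
fortColumns-wrap 1 = tt
fortColumns-wrap 2 = tt
fortColumns-wrap 3 = tt
fortColumns-wrap (suc (suc (suc (suc m)))) = fortColumns-wrap m

fortColumns-cyclic : ∀ m → CyclicWindows fortWindowᵇ (fortColumns (3 + m))
fortColumns-cyclic zero    = cyclic-from-linear fortWindowᵇ (fortColumns 3) tt
fortColumns-cyclic (suc m) = cyclic-from-linear fortWindowᵇ (fortColumns (4 + m))
  (from (T-∧ {fortWindowᵇ (lookup (fortColumns (4 + m)) (fromℕ (3 + m))) top none})
        (fortColumns-wrap m , fortColumns-windows m))

fortColumns-size : ∀ n → ⌈ n /2⌉ + 3 * (n / 4) ≤
                   ∣ ∁ (row zero (fortColumns n)) ∣ + ∣ ∁ (row (suc zero) (fortColumns n)) ∣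
fortColumns-size 0 = z≤n
fortColumns-size 1 = s≤s z≤n
fortColumns-size 2 = s≤s z≤n
fortColumns-size 3 = s≤s (s≤s z≤n)
fortColumns-size (suc (suc (suc (suc m)))) = begin
  ⌈ 4 + m /2⌉ + 3 * ((4 + m) / 4) ≡⟨ cong (λ q → 2 + ⌈ m /2⌉ + 3 * q) (m/n≡1+[m∸n]/n {4 + m} {4} (s≤s (s≤s (s≤s (s≤s z≤n))))) ⟩
  2 + ⌈ m /2⌉ + 3 * (1 + m / 4)    ≡⟨ regroup ⌈ m /2⌉ (m / 4) ⟩
  5 + (⌈ m /2⌉ + 3 * (m / 4))      ≤⟨ +-monoʳ-≤ 5 (fortColumns-size m) ⟩
  5 + (r₀ + r₁)                    ≡⟨ split r₀ r₁ ⟩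
  (2 + r₀) + (3 + r₁)              ∎
  where
    open ≤-Reasoning
    r₀ r₁ : ℕ
    r₀ = ∣ ∁ (row zero (fortColumns m)) ∣
    r₁ = ∣ ∁ (row (suc zero) (fortColumns m)) ∣
    regroup : ∀ a b → 2 + a + 3 * (1 + b) ≡ 5 + (a + 3 * b)
    regroup = solve-∀
    split : ∀ a b → 5 + (a + b) ≡ (2 + a) + (3 + b)
    split = solve-∀

theorem3p6 : (n : ℕ) → n > 2 →
    FailedZFAtLeast (P2□C n) (⌈ n /2⌉ + 3 * (n / 4))
theorem3p6 0 ()
theorem3p6 1 (s≤s ())
theorem3p6 2 (s≤s (s≤s ()))
theorem3p6 (suc (suc (suc m))) n>2 =
  ∁ (fortOf w) ,
  ∁-fort-failed (fortOf-isFort n>2 w (fortColumns-cyclic m)) (fortOf-nonempty w (fortColumns-head m)) ,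
  subst (⌈ 3 + m /2⌉ + 3 * ((3 + m) / 4) ≤_) (sym (∣∁fortOf∣ w)) (fortColumns-size (3 + m))
  where
    w : Vec Column (3 + m)
    w = fortColumns (3 + m)
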